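{- Let $X$ be a non-empty finite set and let $\mathcal{R}$ be a rooted (binary) phylogenetic network on $X$. If there exists a tree-child cherry-picking sequence associated with a complete cherry-reduction sequence for $\mathcal{R}$, then $\mathcal{R}$ is tree-child.
   Context: A rooted (binary) phylogenetic network on $X$ is a directed acyclic graph with no loops and no parallel arcs such that: (i) there is a unique vertex $\rho$ (the root) with in-degree 0 and out-degree 2; (ii) every vertex of out-degree 0 has in-degree 1, and the set of out-degree-0 vertices (leaves) is $X$; (iii) every other vertex has either in-degree 1 and out-degree 2 (a tree vertex) or in-degree 2 and out-degree 1 (a reticulation). If $|X|=1$, the single isolated vertex labelled by the element of $X$ is also a rooted phylogenetic network, and it is its own root. An arc directed into a reticulation is a reticulation arc. For a leaf $a$, $p_a$ denotes its unique parent. The reticulation number $r(\mathcal{R})$ is the number of reticulations. A rooted phylogenetic network is tree-child if every non-leaf vertex has a child that is a tree vertex or a leaf (equivalently, no two reticulations are joined by an arc and no two reticulations share a parent). For distinct $a,b\in X$: $[a,b]$ is a cherry of $\mathcal{R}$ if $p_a=p_b$; $(a,b)$ is a reticulated cherry (with reticulation leaf $a$) if $p_a$ is a reticulation and $(p_b,p_a)$ is an arc. Reducing the cherry $[a,b]$ means deleting $a$ and suppressing the resulting degree-2 vertex if $p_a\neq\rho$, and deleting $a$ and $p_a$ if $p_a=\rho$. Reducing the reticulated cherry $(a,b)$ means deleting the arc $(p_b,p_a)$ and suppressing the two resulting degree-2 vertices. These operations are cherry reductions. A cherry-reduction sequence for $\mathcal{R}$ is a sequence $(\mathcal{R}=\mathcal{R}_0,\mathcal{R}_1,\ldots,\mathcal{R}_k)$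 where each $\mathcal{R}_i$ is obtained from $\mathcal{R}_{i-1}$ by a cherry reduction; it is complete if $\mathcal{R}_k$ is a single vertex. The cherry-picking sequence associated with it is $(r_1,\ldots,r_k)$, where $r_i=[x_i,y_i]$ if $\mathcal{R}_i$ is obtained by reducing the cherry $[x_i,y_i]$ and $r_i=(x_i,y_i)$ if it is obtained by reducing the reticulated cherry $(x_i,y_i)$. We say $r_i$ contains $x_i$ and $y_i$. For a cherry-picking sequence $\Sigma=(r_1,\ldots,r_k)$ and $i\in\{1,\ldots,k\}$, let $s(i)$ be the smallest $j\in\{i+1,\ldots,k\}$ such that $r_j$ contains $x_i$ (the first coordinate of $r_i$), with $s(i)=\infty$ if no such $j$ exists; if $s(i)\neq\infty$, $S(i)=r_{s(i)}$ is the successor pair of $r_i$. $\Sigma$ is tree-child if (P1) for every $i$ with $r_i=(x_i,y_i)$ and $s(i)=j\neq\infty$, $S(i)$ is of the form $[x_j,y_j]$ (a cherry pair); and (P2) for any two distinct $i,j$ with $r_i=(x_i,y_i)$, $r_j=(x_j,y_j)$, $s(i)\neq\infty$, $s(j)\neq\infty$, we have $s(i)\neq s(j)$. -}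

module Defs where

open import Data.Nat using (ℕ)
open import Data.Sum using (_⊎_; inj₁; inj₂)
open import Data.Product using (Σ; ∃; ∃-syntax; _×_; _,_; proj₁)
open import Data.List using (List; length; lookup; _∷_; [])
open import Data.List.Membership.Propositional using (_∈_)
open import Data.Fin using (Fin) renaming (_<_ to _<ᶠ_)
open import Relation.Nullary using (¬_)
open import Relation.Binary.PropositionalEquality using (_≡_; _≢_)
open import Relation.Binary.Construct.Closure.Transitive using (TransClosure)
open import Function.Bundles using (_⇔_)
open import Data.Empty using (⊥)
open import Data.Unit using (⊤)

-- Vertices. Leaves are the vertices `inj₁ x` (labelled by x ∈ L);
-- all other vertices are named by natural numbers `inj₂ n`.

Vtx : Set → Set
Vtx L = L ⊎ ℕ

-- A finite directed graph on vertex names `Vtx L`, given by a vertex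
-- predicate and an arc relation (so there are no parallel arcs).
record Graph (L : Set) : Set₁ where
  field
    V : Vtx L → Set
    A : Vtx L → Vtx L → Set
    arcs-in-V : ∀ u w → A u w → V u × V w
    finite : Σ (List (Vtx L)) λ vs → ∀ v → V v → v ∈ vs
open Graph public

module _ {L : Set} (G : Graph L) where

  InDeg0 : Vtx L → Set
  InDeg0 v = ∀ u → ¬ A G u v

  InDeg1 : Vtx L → Set
  InDeg1 v = ∃[ u ] (A G u v × (∀ w → A G w v → w ≡ u))

  InDeg2 : Vtx L → Set
  InDeg2 v = ∃[ u ] ∃[ u' ] (u ≢ u' × A G u v × A G u' v
                            × (∀ w → A G w v → (w ≡ u) ⊎ (w ≡ u')))

  OutDeg0 : Vtx L → Set
  OutDeg0 v = ∀ w → ¬ A G v w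

  OutDeg1 : Vtx L → Set
  OutDeg1 v = ∃[ w ] (A G v w × (∀ w' → A G v w' → w' ≡ w))

  OutDeg2 : Vtx L → Set
  OutDeg2 v = ∃[ w ] ∃[ w' ] (w ≢ w' × A G v w × A G v w'
                             × (∀ z → A G v z → (z ≡ w) ⊎ (z ≡ w')))

  IsLabelled : Vtx L → Set
  IsLabelled v = ∃[ x ] (v ≡ inj₁ x)

  IsLeaf : Vtx L → Set
  IsLeaf v = V G v × OutDeg0 v

  IsTreeVertex : Vtx L → Set
  IsTreeVertex v = V G v × InDeg1 v × OutDeg2 v

  IsReticulation : Vtx L → Set
  IsReticulation v = V G v × InDeg2 v × OutDeg1 v

  IsRoot : Vtx L → Set
  IsRoot v = V G v × InDeg0 v

  Acyclic : Set
  Acyclic = ∀ v → ¬ TransClosure (A G) v v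

  -- a rooted binary phylogenetic network with at least two vertices
  IsBigNetwork : Set
  IsBigNetwork =
    Acyclic
    × (∃[ ρ ] (V G ρ × InDeg0 ρ × OutDeg2 ρ × (∀ v → V G v → InDeg0 v → v ≡ ρ)))
    × (∀ v → V G v → OutDeg0 v → InDeg1 v)
    × (∀ v → V G v → (OutDeg0 v ⇔ IsLabelled v))
    × (∀ v → V G v → ¬ InDeg0 v → ¬ OutDeg0 v →
         (InDeg1 v × OutDeg2 v) ⊎ (InDeg2 v × OutDeg1 v))

  IsSingleLeaf : Set
  IsSingleLeaf = ∃[ x ] ((∀ v → V G v ⇔ (v ≡ inj₁ x)) × (∀ u w → ¬ A G u w))

  -- rooted (binary) phylogenetic network on X = {x | V (inj₁ x)}
  IsNetwork : Set
  IsNetwork = IsBigNetwork ⊎ IsSingleLeaf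

  IsSingleVertex : Set
  IsSingleVertex = ∃[ v ] (∀ w → V G w ⇔ (w ≡ v))

  IsTreeChild : Set
  IsTreeChild = ∀ v → V G v → ¬ OutDeg0 v →
                ∃[ c ] (A G v c × (IsTreeVertex c ⊎ IsLeaf c))

data Pair (L : Set) : Set where
  cher : L → L → Pair L
  ret  : L → L → Pair L

fstP : {L : Set} → Pair L → L
fstP (cher x y) = x
fstP (ret x y) = x

Contains : {L : Set} → Pair L → L → Set
Contains (cher x y) z = (z ≡ x) ⊎ (z ≡ y)
Contains (ret x y) z = (z ≡ x) ⊎ (z ≡ y)

IsCherryPair : {L : Set} → Pair L → Set
IsCherryPair (cher _ _) = ⊤
IsCherryPair (ret _ _) = ⊥

IsRetPair : {L : Set} → Pair L → Set
IsRetPair (cher _ _) = ⊥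
IsRetPair (ret _ _) = ⊤

module _ {L : Set} where

  Reduces : Graph L → Pair L → Graph L → Set
  -- cherry [a,b] whose common parent p is the root: delete a and p
  -- cherry [a,b] whose common parent p has parent g: delete a, suppress p
  Reduces R (cher a b) R' =
    a ≢ b × IsLeaf R (inj₁ a) × IsLeaf R (inj₁ b) ×
    ∃[ p ] (A R p (inj₁ a) × A R p (inj₁ b) ×
      (∀ v → V R' v ⇔ (V R v × v ≢ inj₁ a × v ≢ p)) ×
      ( (IsRoot R p ×
          (∀ u w → A R' u w ⇔ (A R u w × u ≢ inj₁ a × u ≢ p × w ≢ inj₁ a × w ≢ p)))
      ⊎ (∃[ g ] (A R g p ×
          (∀ u w → A R' u w ⇔
             ((A R u w × u ≢ inj₁ a × u ≢ p × w ≢ inj₁ a × w ≢ p)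
              ⊎ (u ≡ g × w ≡ inj₁ b)))))))
  -- reticulated cherry (a,b): p_a a reticulation with parents p_b and q,
  -- p_b with parent g; delete the arc (p_b,p_a), suppress p_b and p_a
  Reduces R (ret a b) R' =
    a ≢ b × IsLeaf R (inj₁ a) × IsLeaf R (inj₁ b) ×
    ∃[ pa ] ∃[ pb ] ∃[ q ] ∃[ g ]
      (A R pa (inj₁ a) × A R pb (inj₁ b) × IsReticulation R pa ×
       A R pb pa × A R q pa × q ≢ pb × A R g pb ×
       (∀ v → V R' v ⇔ (V R v × v ≢ pa × v ≢ pb)) ×
       (∀ u w → A R' u w ⇔
          ((A R u w × u ≢ pa × u ≢ pb × w ≢ pa × w ≢ pb)
           ⊎ (u ≡ g × w ≡ inj₁ b)
           ⊎ (u ≡ q × w ≡ inj₁ a))))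

  data CompleteCRS : Graph L → List (Pair L) → Set₁ where
    done : ∀ {R} → IsNetwork R → IsSingleVertex R → CompleteCRS R []
    step : ∀ {R R' r σ} → IsNetwork R → Reduces R r R' →
           CompleteCRS R' σ → CompleteCRS R (r ∷ σ)

  IsSucc : (σ : List (Pair L)) → Fin (length σ) → Fin (length σ) → Set
  IsSucc σ i j =
    i <ᶠ j × Contains (lookup σ j) (fstP (lookup σ i)) ×
    (∀ k → i <ᶠ k → k <ᶠ j → ¬ Contains (lookup σ k) (fstP (lookup σ i)))

  IsTreeChildSeq : List (Pair L) → Set
  IsTreeChildSeq σ =
    -- (P1)
    (∀ i j → IsRetPair (lookup σ i) → IsSucc σ i j → IsCherryPair (lookup σ j))
    -- (P2)
    × (∀ i i' j → i ≢ i' → IsRetPair (lookup σ i) → IsRetPair (lookup σ i') →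
         IsSucc σ i j → IsSucc σ i' j → ⊥)

module Submission where

-- A network is tree-child iff no vertex has
-- only reticulations as children, and a reduction R ↦ R' keeps such a vertex, together
-- with its reticulation children, in R' — except the other parent q of the reticulation
-- dissolved by reducing (x, y), which becomes the parent of x. For q the conditions
-- (P1), (P2) at (x, y) take over: along the rest of the sequence they forbid the parent
-- of x to be a reticulation (x is next picked in a cherry) or to have a reticulation
-- child, since dissolving that reticulation by a pair (x', y') would make x and x'
-- siblings, which must then be picked together, against (P2).

open import Defs
open import Data.Product using (∃-syntax; _×_; _,_; proj₁; proj₂)
open import Data.Sum using (_⊎_; inj₁; inj₂)
open import Data.Sum.Properties using (inj₁-injective; inj₂-injective)
open import Data.Empty using (⊥; ⊥-elim)
open import Data.Unit using (⊤; tt)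
open import Data.Nat using (s≤s; z≤n) renaming (_≟_ to _≟ℕ_)
open import Data.Fin using (Fin; zero; suc) renaming (_<_ to _<ᶠ_)
open import Data.Fin.Properties using (suc-injective)
open import Data.List using (List; []; _∷_; length; lookup)
open import Relation.Nullary using (¬_; yes; no)
open import Relation.Binary.PropositionalEquality using (_≡_; _≢_; refl; sym; trans; subst)
open import Relation.Binary.Construct.Closure.Transitive using ([_])
open import Function.Base using (_∘_)
open import Function.Bundles using (Equivalence; _⇔_)
open Equivalence using (to; from)

-- Vertex equality is undecidable (L is arbitrary), so case splits on vertices
-- are made under a goal of ⊥.
⊥-by-cases : {P : Set} → (P → ⊥) → (¬ P → ⊥) → ⊥
⊥-by-cases p⇒⊥ ¬p⇒⊥ = ¬p⇒⊥ p⇒⊥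

no-third : {A : Set} {w w' z₁ z₂ z : A} → z₁ ≢ z₂ →
           z₁ ≡ w ⊎ z₁ ≡ w' → z₂ ≡ w ⊎ z₂ ≡ w' → z ≡ w ⊎ z ≡ w' → z ≢ z₁ → z ≢ z₂ → ⊥
no-third z₁≢z₂ (inj₁ e₁) (inj₁ e₂) _ _ _ = z₁≢z₂ (trans e₁ (sym e₂))
no-third z₁≢z₂ (inj₂ e₁) (inj₂ e₂) _ _ _ = z₁≢z₂ (trans e₁ (sym e₂))
no-third _ (inj₁ e₁) (inj₂ e₂) (inj₁ e) z≢z₁ _ = z≢z₁ (trans e (sym e₁))
no-third _ (inj₁ e₁) (inj₂ e₂) (inj₂ e) _ z≢z₂ = z≢z₂ (trans e (sym e₂))
no-third _ (inj₂ e₁) (inj₁ e₂) (inj₁ e) _ z≢z₂ = z≢z₂ (trans e (sym e₂))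
no-third _ (inj₂ e₁) (inj₁ e₂) (inj₂ e) z≢z₁ _ = z≢z₁ (trans e (sym e₁))

inj₁-≢ : {L : Set} {x y : L} → x ≢ y → _≢_ {A = Vtx L} (inj₁ x) (inj₁ y)
inj₁-≢ x≢y refl = x≢y refl

TreeOrLeaf : {L : Set} → Graph L → Vtx L → Set
TreeOrLeaf G c = IsTreeVertex G c ⊎ IsLeaf G c

ReticulationsOnly : {L : Set} → Graph L → Vtx L → Set
ReticulationsOnly G v = ∀ c → A G v c → IsReticulation G c

module Reticulations {L : Set} (G : Graph L) where

  reticulation-child-unique : ∀ {c w w'} → IsReticulation G c → A G c w → A G c w' → w ≡ w'
  reticulation-child-unique (_ , _ , (_ , _ , unique)) c→w c→w' =
    trans (unique _ c→w) (sym (unique _ c→w'))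

  reticulation-no-third-parent : ∀ {c s t w} → IsReticulation G c → A G s c → A G t c → s ≢ t →
                                 A G w c → w ≢ s → w ≢ t → ⊥
  reticulation-no-third-parent (_ , (_ , _ , _ , _ , _ , parents) , _) s→c t→c s≢t w→c =
    no-third s≢t (parents _ s→c) (parents _ t→c) (parents _ w→c)

  treeOrLeaf⇒¬reticulation : ∀ {c} → TreeOrLeaf G c → ¬ IsReticulation G c
  treeOrLeaf⇒¬reticulation (inj₁ (_ , (_ , _ , parent) , _)) (_ , (s , t , s≢t , s→c , t→c , _) , _) =
    s≢t (trans (parent s s→c) (sym (parent t t→c)))
  treeOrLeaf⇒¬reticulation (inj₂ (_ , out0)) (_ , _ , (w , c→w , _)) = out0 w c→w

module BigNetwork {L : Set} {G : Graph L} (N : IsBigNetwork G) where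
  open Reticulations G public
  private
    acyclic : Acyclic G
    acyclic = proj₁ N

    root : ∃[ ρ ] (V G ρ × InDeg0 G ρ × OutDeg2 G ρ × (∀ v → V G v → InDeg0 G v → v ≡ ρ))
    root = proj₁ (proj₂ N)

    leaf-inDeg1 : ∀ v → V G v → OutDeg0 G v → InDeg1 G v
    leaf-inDeg1 = proj₁ (proj₂ (proj₂ N))

    outDeg0⇔labelled : ∀ v → V G v → OutDeg0 G v ⇔ IsLabelled G v
    outDeg0⇔labelled = proj₁ (proj₂ (proj₂ (proj₂ N)))

    inner-kinds : ∀ v → V G v → ¬ InDeg0 G v → ¬ OutDeg0 G v →
                  (InDeg1 G v × OutDeg2 G v) ⊎ (InDeg2 G v × OutDeg1 G v)
    inner-kinds = proj₂ (proj₂ (proj₂ (proj₂ N)))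

  source∈V : ∀ {u w} → A G u w → V G u
  source∈V {u} {w} u→w = proj₁ (arcs-in-V G u w u→w)

  target∈V : ∀ {u w} → A G u w → V G w
  target∈V {u} {w} u→w = proj₂ (arcs-in-V G u w u→w)

  labelled-outDeg0 : ∀ {x} → V G (inj₁ x) → OutDeg0 G (inj₁ x)
  labelled-outDeg0 {x} x∈V = from (outDeg0⇔labelled (inj₁ x) x∈V) (x , refl)

  leaf-no-arc : ∀ {x w} → ¬ A G (inj₁ x) w
  leaf-no-arc {w = w} x→w = labelled-outDeg0 (source∈V x→w) w x→w

  no-loop : ∀ {u} → ¬ A G u u
  no-loop u→u = acyclic _ [ u→u ]

  leaf-parent-unique : ∀ {x u u'} → A G u (inj₁ x) → A G u' (inj₁ x) → u ≡ u'
  leaf-parent-unique u→x u'→x with leaf-inDeg1 _ (target∈V u→x) (labelled-outDeg0 (target∈V u→x))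
  ... | _ , _ , parent = trans (parent _ u→x) (sym (parent _ u'→x))

  arc-source-unlabelled : ∀ {u w x} → A G u w → u ≢ inj₁ x
  arc-source-unlabelled u→w refl = leaf-no-arc u→w

  reticulation-unlabelled : ∀ {c x} → IsReticulation G c → c ≢ inj₁ x
  reticulation-unlabelled (_ , _ , (_ , c→w , _)) = arc-source-unlabelled c→w

  -- The root is unlabelled, so it can be recognised by comparing natural numbers.
  outDeg2⊎reticulation : ∀ {u} → V G u → ¬ OutDeg0 G u → OutDeg2 G u ⊎ IsReticulation G u
  outDeg2⊎reticulation {inj₁ x} u∈V ¬out0 = ⊥-elim (¬out0 (labelled-outDeg0 u∈V))
  outDeg2⊎reticulation {inj₂ n} u∈V ¬out0 with root
  ... | inj₁ _ , _ , _ , (_ , _ , _ , ρ→w , _) , _ = ⊥-elim (leaf-no-arc ρ→w)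
  ... | inj₂ m , _ , _ , ρ-out2 , root-unique with n ≟ℕ m
  ...   | yes refl = inj₁ ρ-out2
  ...   | no n≢m with inner-kinds (inj₂ n) u∈V (λ in0 → n≢m (inj₂-injective (root-unique _ u∈V in0))) ¬out0
  ...     | inj₁ (_ , out2) = inj₁ out2
  ...     | inj₂ (in2 , out1) = inj₂ (u∈V , in2 , out1)

  at-most-two-children : ∀ {u z₁ z₂ z} → A G u z₁ → A G u z₂ → z₁ ≢ z₂ →
                         A G u z → z ≢ z₁ → z ≢ z₂ → ⊥
  at-most-two-children u→z₁ u→z₂ z₁≢z₂ u→z with outDeg2⊎reticulation (source∈V u→z₁) (λ out0 → out0 _ u→z₁)
  ... | inj₁ (_ , _ , _ , _ , _ , children) =
        no-third z₁≢z₂ (children _ u→z₁) (children _ u→z₂) (children _ u→z)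
  ... | inj₂ u-ret = ⊥-elim (z₁≢z₂ (reticulation-child-unique u-ret u→z₁ u→z₂))

  second-child-or-reticulation : ∀ {u z} → A G u z → (∀ {c} → A G u c → c ≢ z → ⊥) →
                                 ¬ IsReticulation G u → ⊥
  second-child-or-reticulation {z = z} u→z only-z ¬ret
    with outDeg2⊎reticulation (source∈V u→z) (λ out0 → out0 _ u→z)
  ... | inj₁ (w , w' , w≢w' , u→w , u→w' , _) =
        ⊥-by-cases (λ (w≡z : w ≡ z) → only-z u→w' (λ w'≡z → w≢w' (trans w≡z (sym w'≡z))))
                   (only-z u→w)
  ... | inj₂ u-ret = ¬ret u-ret

  branching-parent-unique : ∀ {g g' u z₁ z₂} → A G g u → A G u z₁ → A G u z₂ → z₁ ≢ z₂ →
                            A G g' u → g ≡ g'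
  branching-parent-unique {u = u} g→u u→z₁ u→z₂ z₁≢z₂ g'→u
    with inner-kinds u (source∈V u→z₁) (λ in0 → in0 _ g→u) (λ out0 → out0 _ u→z₁)
  ... | inj₁ ((_ , _ , parent) , _) = trans (parent _ g→u) (sym (parent _ g'→u))
  ... | inj₂ (_ , (_ , _ , child)) = ⊥-elim (z₁≢z₂ (trans (child _ u→z₁) (sym (child _ u→z₂))))

  two-parents⇒reticulation : ∀ {c w s t} → A G c w → A G s c → A G t c → s ≢ t → IsReticulation G c
  two-parents⇒reticulation {c} c→w s→c t→c s≢t
    with inner-kinds c (source∈V c→w) (λ in0 → in0 _ s→c) (λ out0 → out0 _ c→w)
  ... | inj₁ ((_ , _ , parent) , _) = ⊥-elim (s≢t (trans (parent _ s→c) (sym (parent _ t→c))))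
  ... | inj₂ (in2 , out1) = source∈V c→w , in2 , out1

  unlabelled-¬outDeg0 : ∀ {n} → V G (inj₂ n) → ¬ OutDeg0 G (inj₂ n)
  unlabelled-¬outDeg0 n∈V out0 with to (outDeg0⇔labelled _ n∈V) out0
  ... | _ , ()

  treeOrLeaf⊎reticulation : ∀ {v c} → A G v c → TreeOrLeaf G c ⊎ IsReticulation G c
  treeOrLeaf⊎reticulation {c = inj₁ x} v→x = inj₁ (inj₂ (target∈V v→x , labelled-outDeg0 (target∈V v→x)))
  treeOrLeaf⊎reticulation {c = inj₂ m} v→c
    with inner-kinds (inj₂ m) (target∈V v→c) (λ in0 → in0 _ v→c) (unlabelled-¬outDeg0 (target∈V v→c))
  ... | inj₁ (in1 , out2) = inj₁ (inj₁ (target∈V v→c , in1 , out2))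
  ... | inj₂ (in2 , out1) = inj₂ (target∈V v→c , in2 , out1)

  ¬reticulationsOnly⇒treeChild : (∀ {v c} → A G v c → ¬ ReticulationsOnly G v) → IsTreeChild G
  ¬reticulationsOnly⇒treeChild never v v∈V ¬out0 with outDeg2⊎reticulation v∈V ¬out0
  ... | inj₂ (_ , _ , (w , v→w , only-w)) with treeOrLeaf⊎reticulation v→w
  ...   | inj₁ w-ok = w , v→w , w-ok
  ...   | inj₂ w-ret = ⊥-elim (never v→w λ c v→c → subst (IsReticulation G) (sym (only-w c v→c)) w-ret)
  ¬reticulationsOnly⇒treeChild never v v∈V ¬out0 | inj₁ (w , w' , _ , v→w , v→w' , children)
    with treeOrLeaf⊎reticulation v→w | treeOrLeaf⊎reticulation v→w'
  ... | inj₁ w-ok | _ = w , v→w , w-ok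
  ... | inj₂ _ | inj₁ w'-ok = w' , v→w' , w'-ok
  ... | inj₂ w-ret | inj₂ w'-ret = ⊥-elim (never v→w λ c v→c → either-reticulation (children c v→c))
    where
    either-reticulation : ∀ {c} → c ≡ w ⊎ c ≡ w' → IsReticulation G c
    either-reticulation (inj₁ refl) = w-ret
    either-reticulation (inj₂ refl) = w'-ret

-- Both cases of a cherry reduction (p the root or not); bypass-arc is vacuous when p is the root.
record CherryReduction {L : Set} (G G' : Graph L) (x y : L) : Set where
  field
    p : Vtx L
    x≢y : x ≢ y
    p→x : A G p (inj₁ x)
    p→y : A G p (inj₁ y)
    kept-vertex : ∀ {v} → V G v → v ≢ inj₁ x → v ≢ p → V G' v
    kept-arc : ∀ {u w} → A G u w → u ≢ inj₁ x → u ≢ p → w ≢ inj₁ x → w ≢ p → A G' u w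
    arc-origin : ∀ {u w} → A G' u w → A G u w ⊎ A G u p
    bypass-arc : ∀ {u} → A G u p → A G' u (inj₁ y)

record ReticulatedCherryReduction {L : Set} (G G' : Graph L) (x y : L) : Set where
  field
    px py q g : Vtx L
    x≢y : x ≢ y
    px→x : A G px (inj₁ x)
    py→y : A G py (inj₁ y)
    px-reticulation : IsReticulation G px
    py→px : A G py px
    q→px : A G q px
    q≢py : q ≢ py
    g→py : A G g py
    kept-vertex : ∀ {v} → V G v → v ≢ px → v ≢ py → V G' v
    kept-arc : ∀ {u w} → A G u w → u ≢ px → u ≢ py → w ≢ px → w ≢ py → A G' u w
    g→y : A G' g (inj₁ y)
    q→x : A G' q (inj₁ x)
    arc-origin : ∀ {u w} → A G' u w → (A G u w × w ≢ px) ⊎ (u ≡ g) ⊎ (u ≡ q)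

module _ {L : Set} {G G' : Graph L} {x y : L} where

  cherryReduction : IsBigNetwork G → Reduces G (cher x y) G' → CherryReduction G G' x y
  cherryReduction _ (x≢y , _ , _ , p , p→x , p→y , V⇔ , inj₁ ((_ , p-root) , A⇔)) = record
    { p = p ; x≢y = x≢y ; p→x = p→x ; p→y = p→y
    ; kept-vertex = λ v∈V v≢x v≢p → from (V⇔ _) (v∈V , v≢x , v≢p)
    ; kept-arc = λ u→w u≢x u≢p w≢x w≢p → from (A⇔ _ _) (u→w , u≢x , u≢p , w≢x , w≢p)
    ; arc-origin = λ u→w → inj₁ (proj₁ (to (A⇔ _ _) u→w))
    ; bypass-arc = λ u→p → ⊥-elim (p-root _ u→p) }
  cherryReduction N (x≢y , _ , _ , p , p→x , p→y , V⇔ , inj₂ (g , g→p , A⇔)) = record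
    { p = p ; x≢y = x≢y ; p→x = p→x ; p→y = p→y
    ; kept-vertex = λ v∈V v≢x v≢p → from (V⇔ _) (v∈V , v≢x , v≢p)
    ; kept-arc = λ u→w u≢x u≢p w≢x w≢p → from (A⇔ _ _) (inj₁ (u→w , u≢x , u≢p , w≢x , w≢p))
    ; arc-origin = origin
    ; bypass-arc = bypass }
    where
    origin : ∀ {u w} → A G' u w → A G u w ⊎ A G u p
    origin u→w with to (A⇔ _ _) u→w
    ... | inj₁ (u→w , _) = inj₁ u→w
    ... | inj₂ (refl , refl) = inj₂ g→p
    bypass : ∀ {u} → A G u p → A G' u (inj₁ y)
    bypass u→p with BigNetwork.branching-parent-unique {G = G} N g→p p→x p→y (inj₁-≢ x≢y) u→p
    ... | refl = from (A⇔ _ _) (inj₂ (refl , refl))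

  reticulatedCherryReduction : Reduces G (ret x y) G' → ReticulatedCherryReduction G G' x y
  reticulatedCherryReduction
    (x≢y , _ , _ , px , py , q , g , px→x , py→y , px-ret , py→px , q→px , q≢py , g→py , V⇔ , A⇔) = record
    { px = px ; py = py ; q = q ; g = g ; x≢y = x≢y ; px→x = px→x ; py→y = py→y
    ; px-reticulation = px-ret ; py→px = py→px ; q→px = q→px ; q≢py = q≢py ; g→py = g→py
    ; kept-vertex = λ v∈V v≢px v≢py → from (V⇔ _) (v∈V , v≢px , v≢py)
    ; kept-arc = λ u→w u≢px u≢py w≢px w≢py → from (A⇔ _ _) (inj₁ (u→w , u≢px , u≢py , w≢px , w≢py))
    ; g→y = from (A⇔ _ _) (inj₂ (inj₁ (refl , refl)))
    ; q→x = from (A⇔ _ _) (inj₂ (inj₂ (refl , refl)))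
    ; arc-origin = origin }
    where
    origin : ∀ {u w} → A G' u w → (A G u w × w ≢ px) ⊎ (u ≡ g) ⊎ (u ≡ q)
    origin u→w with to (A⇔ _ _) u→w
    ... | inj₁ (u→w , _ , _ , w≢px , _) = inj₁ (u→w , w≢px)
    ... | inj₂ (inj₁ (u≡g , _)) = inj₂ (inj₁ u≡g)
    ... | inj₂ (inj₂ (u≡q , _)) = inj₂ (inj₂ u≡q)

module CherryReductionProperties {L : Set} {G G' : Graph L} {x y : L}
         (N : IsBigNetwork G) (D : CherryReduction G G' x y) where
  open BigNetwork {G = G} N
  open CherryReduction D

  pair-parent : ∀ {a u} → Contains (cher x y) a → A G u (inj₁ a) → u ≡ p
  pair-parent (inj₁ refl) u→a = leaf-parent-unique u→a p→x
  pair-parent (inj₂ refl) u→a = leaf-parent-unique u→a p→y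

  labelled≢p : ∀ {z} → inj₁ z ≢ p
  labelled≢p z≡p = arc-source-unlabelled p→x (sym z≡p)

  p-children : ∀ {z} → A G p z → z ≢ inj₁ x → z ≢ inj₁ y → ⊥
  p-children = at-most-two-children p→x p→y (inj₁-≢ x≢y)

  reticulation≢p : ∀ {c} → IsReticulation G c → c ≢ p
  reticulation≢p c-ret refl = inj₁-≢ x≢y (reticulation-child-unique c-ret p→x p→y)

  kept-leaf-arc : ∀ {u a} → A G u (inj₁ a) → ¬ Contains (cher x y) a → A G' u (inj₁ a)
  kept-leaf-arc u→a a∉xy =
    kept-arc u→a (arc-source-unlabelled u→a)
      (λ { refl → p-children u→a (inj₁-≢ (a∉xy ∘ inj₁)) (inj₁-≢ (a∉xy ∘ inj₂)) })
      (inj₁-≢ (a∉xy ∘ inj₁)) labelled≢p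

  kept-arc-into-reticulation : ∀ {u c} → A G u c → IsReticulation G c → A G' u c
  kept-arc-into-reticulation u→c c-ret =
    kept-arc u→c (arc-source-unlabelled u→c)
      (λ { refl → p-children u→c (reticulation-unlabelled c-ret) (reticulation-unlabelled c-ret) })
      (reticulation-unlabelled c-ret) (reticulation≢p c-ret)

  still-has-child : ∀ {v w} → A G v w → v ≢ p → ¬ OutDeg0 G' v
  still-has-child {v} v→w v≢p no-child =
    ⊥-by-cases (λ w≡x → v≢p (leaf-parent-unique (subst (A G v) w≡x v→w) p→x)) λ w≢x →
    ⊥-by-cases (λ w≡p → no-child _ (bypass-arc (subst (A G v) w≡p v→w))) λ w≢p →
    no-child _ (kept-arc v→w (arc-source-unlabelled v→w) v≢p w≢x w≢p)

  reticulation-preserved : IsBigNetwork G' → ∀ {c} → IsReticulation G c → ¬ ¬ IsReticulation G' c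
  reticulation-preserved N' c-ret@(_ , (s , t , s≢t , s→c , t→c , _) , (_ , c→w , _)) ¬c-ret' =
    still-has-child c→w (reticulation≢p c-ret) λ _ c→w' →
      ¬c-ret' (BigNetwork.two-parents⇒reticulation {G = G'} N' c→w'
                 (kept-arc-into-reticulation s→c c-ret) (kept-arc-into-reticulation t→c c-ret) s≢t)

module ReticulatedCherryReductionProperties {L : Set} {G G' : Graph L} {x y : L}
         (N : IsBigNetwork G) (D : ReticulatedCherryReduction G G' x y) where
  open BigNetwork {G = G} N
  open ReticulatedCherryReduction D

  labelled≢px : ∀ {z} → inj₁ z ≢ px
  labelled≢px z≡px = arc-source-unlabelled px→x (sym z≡px)

  labelled≢py : ∀ {z} → inj₁ z ≢ py
  labelled≢py z≡py = arc-source-unlabelled py→y (sym z≡py)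

  py-children : ∀ {z} → A G py z → z ≢ inj₁ y → z ≢ px → ⊥
  py-children = at-most-two-children py→y py→px labelled≢px

  px-child : ∀ {z} → A G px z → z ≡ inj₁ x
  px-child px→z = reticulation-child-unique px-reticulation px→z px→x

  px-no-third-parent : ∀ {w} → A G w px → w ≢ py → w ≢ q → ⊥
  px-no-third-parent w→px w≢py w≢q =
    reticulation-no-third-parent px-reticulation py→px q→px (λ py≡q → q≢py (sym py≡q)) w→px w≢py w≢q

  py-parent : ∀ {w} → A G w py → g ≡ w
  py-parent = branching-parent-unique g→py py→y py→px labelled≢px

  reticulation≢py : ∀ {c} → IsReticulation G c → c ≢ py
  reticulation≢py c-ret refl = labelled≢px (reticulation-child-unique c-ret py→y py→px)

  kept-leaf-arc : ∀ {u a} → A G u (inj₁ a) → ¬ Contains (ret x y) a → A G' u (inj₁ a)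
  kept-leaf-arc u→a a∉xy =
    kept-arc u→a (λ { refl → a∉xy (inj₁ (inj₁-injective (px-child u→a))) })
      (λ { refl → py-children u→a (inj₁-≢ (a∉xy ∘ inj₂)) labelled≢px }) labelled≢px labelled≢py

  kept-arc-into-reticulation : ∀ {u c} → A G u c → IsReticulation G c → c ≢ px → A G' u c
  kept-arc-into-reticulation u→c c-ret c≢px =
    kept-arc u→c (λ { refl → reticulation-unlabelled c-ret (px-child u→c) })
      (λ { refl → py-children u→c (reticulation-unlabelled c-ret) c≢px }) c≢px (reticulation≢py c-ret)

  still-has-child : ∀ {v w} → A G v w → v ≢ px → v ≢ py → ¬ OutDeg0 G' v
  still-has-child {v} v→w v≢px v≢py no-child =
    ⊥-by-cases (λ w≡px →
      ⊥-by-cases (λ v≡q → no-child _ (subst (λ u → A G' u (inj₁ x)) (sym v≡q) q→x))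
                 (px-no-third-parent (subst (A G v) w≡px v→w) v≢py)) λ w≢px →
    ⊥-by-cases (λ w≡py →
      no-child _ (subst (λ u → A G' u (inj₁ y)) (py-parent (subst (A G v) w≡py v→w)) g→y)) λ w≢py →
    no-child _ (kept-arc v→w v≢px v≢py w≢px w≢py)

  reticulation-preserved : IsBigNetwork G' → ∀ {c} → IsReticulation G c → c ≢ px →
                           ¬ ¬ IsReticulation G' c
  reticulation-preserved N' c-ret@(_ , (s , t , s≢t , s→c , t→c , _) , (_ , c→w , _)) c≢px ¬c-ret' =
    still-has-child c→w c≢px (reticulation≢py c-ret) λ _ c→w' →
      ¬c-ret' (BigNetwork.two-parents⇒reticulation {G = G'} N' c→w'
                 (kept-arc-into-reticulation s→c c-ret c≢px) (kept-arc-into-reticulation t→c c-ret c≢px) s≢t)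

PickedApart : {L : Set} → L → L → List (Pair L) → Set
PickedApart a z [] = ⊤
PickedApart a z (r ∷ τ) =
  (Contains r a → ¬ Contains r z) × (¬ Contains r a → ¬ Contains r z → PickedApart a z τ)

-- (P1) and (P2) for a reticulated pair with first coordinate a placed in front of τ.
SuccessorConditions : {L : Set} → L → List (Pair L) → Set
SuccessorConditions a [] = ⊤
SuccessorConditions a (cher x y ∷ τ) = ¬ Contains (cher x y) a → SuccessorConditions a τ
SuccessorConditions a (ret x y ∷ τ) =
  ¬ Contains (ret x y) a × SuccessorConditions a τ × PickedApart a x τ

module _ {L : Set} where

  FirstContaining : L → (τ : List (Pair L)) → Fin (length τ) → Set
  FirstContaining a τ j = Contains (lookup τ j) a × (∀ k → k <ᶠ j → ¬ Contains (lookup τ k) a)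

  FirstContaining-suc : ∀ {r : Pair L} {τ j a} → ¬ Contains r a →
                        FirstContaining a τ j → FirstContaining a (r ∷ τ) (suc j)
  FirstContaining-suc a∉r (a∈j , a∉<j) = a∈j , λ { zero _ → a∉r ; (suc k) (s≤s k<j) → a∉<j k k<j }

  FirstContaining⇒IsSucc : ∀ {r : Pair L} {τ j} → FirstContaining (fstP r) τ j → IsSucc (r ∷ τ) zero (suc j)
  FirstContaining⇒IsSucc (a∈j , a∉<j) = s≤s z≤n , a∈j , λ { zero () _ ; (suc k) _ (s≤s k<j) → a∉<j k k<j }

  IsSucc-suc : ∀ {r : Pair L} {τ i j} → IsSucc τ i j → IsSucc (r ∷ τ) (suc i) (suc j)
  IsSucc-suc (i<j , a∈j , a∉between) =
    s≤s i<j , a∈j , λ { zero () _ ; (suc k) (s≤s i<k) (s≤s k<j) → a∉between k i<k k<j }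

  IsTreeChildSeq-tail : ∀ {r : Pair L} {τ} → IsTreeChildSeq (r ∷ τ) → IsTreeChildSeq τ
  IsTreeChildSeq-tail (P1 , P2) =
    (λ i j i-ret s → P1 (suc i) (suc j) i-ret (IsSucc-suc s)) ,
    (λ i i' j i≢i' i-ret i'-ret s s' →
       P2 (suc i) (suc i') (suc j) (i≢i' ∘ suc-injective) i-ret i'-ret (IsSucc-suc s) (IsSucc-suc s'))

  pickedApart : ∀ {a z} (τ : List (Pair L)) →
                (∀ j → FirstContaining z τ j → ¬ FirstContaining a τ j) → PickedApart a z τ
  pickedApart [] _ = tt
  pickedApart (r ∷ τ) never-together =
    (λ a∈r z∈r → never-together zero (z∈r , λ _ ()) (a∈r , λ _ ())) ,
    (λ a∉r z∉r → pickedApart τ λ j z-first a-first →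
       never-together (suc j) (FirstContaining-suc z∉r z-first) (FirstContaining-suc a∉r a-first))

  successorConditions : ∀ {a} (τ : List (Pair L)) →
    (∀ j → FirstContaining a τ j → IsCherryPair (lookup τ j)) →
    (∀ k j → IsRetPair (lookup τ k) → IsSucc τ k j → ¬ FirstContaining a τ j) →
    SuccessorConditions a τ
  successorConditions [] _ _ = tt
  successorConditions (cher x y ∷ τ) P1 P2 a∉r =
    successorConditions τ (λ j first → P1 (suc j) (FirstContaining-suc a∉r first))
      (λ k j k-ret s first → P2 (suc k) (suc j) k-ret (IsSucc-suc s) (FirstContaining-suc a∉r first))
  successorConditions {a} (ret x y ∷ τ) P1 P2 =
    a∉r ,
    successorConditions τ (λ j first → P1 (suc j) (FirstContaining-suc a∉r first))
      (λ k j k-ret s first → P2 (suc k) (suc j) k-ret (IsSucc-suc s) (FirstContaining-suc a∉r first)) ,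
    pickedApart τ (λ j x-first a-first →
      P2 zero (suc j) tt (FirstContaining⇒IsSucc x-first) (FirstContaining-suc a∉r a-first))
    where
    a∉r : ¬ Contains (ret x y) a
    a∉r a∈r = P1 zero (a∈r , λ _ ())

  IsTreeChildSeq-head : ∀ {a b : L} {τ} → IsTreeChildSeq (ret a b ∷ τ) → SuccessorConditions a τ
  IsTreeChildSeq-head {τ = τ} (P1 , P2) =
    successorConditions τ (λ j first → P1 zero (suc j) tt (FirstContaining⇒IsSucc first))
      (λ k j k-ret s first → P2 zero (suc k) (suc j) (λ ()) tt k-ret (FirstContaining⇒IsSucc first) (IsSucc-suc s))

module _ {L : Set} where

  CompleteCRS-network : ∀ {G : Graph L} {τ} → CompleteCRS G τ → IsNetwork G
  CompleteCRS-network (done G-net _) = G-net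
  CompleteCRS-network (step G-net _ _) = G-net

  arc⇒bigNetwork : ∀ {G : Graph L} {u w} → IsNetwork G → A G u w → IsBigNetwork G
  arc⇒bigNetwork (inj₁ N) _ = N
  arc⇒bigNetwork (inj₂ (_ , _ , no-arcs)) u→w = ⊥-elim (no-arcs _ _ u→w)

  singleVertex-no-arc : ∀ {G : Graph L} {u w} → IsNetwork G → IsSingleVertex G → ¬ A G u w
  singleVertex-no-arc {G} {u} {w} G-net (v , only-v) u→w
    with to (only-v u) (proj₁ (arcs-in-V G u w u→w)) | to (only-v w) (proj₂ (arcs-in-V G u w u→w))
  ... | refl | refl = BigNetwork.no-loop {G = G} (arc⇒bigNetwork {G = G} G-net u→w) u→w

  reduction-keeps-leaf-arc : ∀ {G G' : Graph L} {r q a} → IsBigNetwork G → Reduces G r G' →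
                             A G q (inj₁ a) → ¬ Contains r a → A G' q (inj₁ a)
  reduction-keeps-leaf-arc {G} {G'} {cher x y} N red = kept-leaf-arc
    where
    D : CherryReduction G G' x y
    D = cherryReduction N red
    open CherryReductionProperties N D
  reduction-keeps-leaf-arc {G} {G'} {ret x y} N red = kept-leaf-arc
    where
    D : ReticulatedCherryReduction G G' x y
    D = reticulatedCherryReduction red
    open ReticulatedCherryReductionProperties N D

  siblings-reduced-together : ∀ {G G' : Graph L} {r q a z} → IsBigNetwork G → Reduces G r G' →
                              A G q (inj₁ a) → A G q (inj₁ z) → a ≢ z → Contains r a → ¬ ¬ Contains r z
  siblings-reduced-together {G} {G'} {cher x y} N red q→a q→z _ a∈r z∉r =
    p-children (subst (λ v → A G v (inj₁ _)) (pair-parent a∈r q→a) q→z)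
      (inj₁-≢ (z∉r ∘ inj₁)) (inj₁-≢ (z∉r ∘ inj₂))
    where
    D : CherryReduction G G' x y
    D = cherryReduction N red
    open CherryReductionProperties N D
  siblings-reduced-together {G} {G'} {ret x y} N red q→a q→z a≢z a∈r z∉r = pair-reduced a∈r z∉r
    where
    D : ReticulatedCherryReduction G G' x y
    D = reticulatedCherryReduction red
    open BigNetwork {G = G} N
    open ReticulatedCherryReduction D
    open ReticulatedCherryReductionProperties N D
    pair-reduced : Contains (ret x y) _ → ¬ ¬ Contains (ret x y) _
    pair-reduced (inj₁ refl) _ =
      a≢z (inj₁-injective (sym (px-child (subst (λ v → A G v (inj₁ _)) (leaf-parent-unique q→a px→x) q→z))))
    pair-reduced (inj₂ refl) z∉r =
      py-children (subst (λ v → A G v (inj₁ _)) (leaf-parent-unique q→a py→y) q→z)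
        (inj₁-≢ (z∉r ∘ inj₂)) labelled≢px

  pickedApart⇒¬siblings : ∀ {G : Graph L} {τ a z q} → CompleteCRS G τ → PickedApart a z τ → a ≢ z →
                          A G q (inj₁ a) → ¬ A G q (inj₁ z)
  pickedApart⇒¬siblings {G} (done G-net single) _ _ q→a _ = singleVertex-no-arc {G = G} G-net single q→a
  pickedApart⇒¬siblings {G} (step G-net red crs) (not-both , apart-later) a≢z q→a q→z =
    ⊥-by-cases (λ a∈r → siblings-reduced-together N red q→a q→z a≢z a∈r (not-both a∈r)) λ a∉r →
    ⊥-by-cases (λ z∈r → siblings-reduced-together N red q→z q→a (λ z≡a → a≢z (sym z≡a)) z∈r a∉r) λ z∉r →
    pickedApart⇒¬siblings crs (apart-later a∉r z∉r) a≢z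
      (reduction-keeps-leaf-arc N red q→a a∉r) (reduction-keeps-leaf-arc N red q→z z∉r)
    where
    N : IsBigNetwork G
    N = arc⇒bigNetwork {G = G} G-net q→a

  reticulation-parent-excluded : ∀ {G : Graph L} {τ a u} → CompleteCRS G τ → SuccessorConditions a τ →
                                 A G u (inj₁ a) → ¬ IsReticulation G u
  reticulation-parent-excluded {G} (done G-net single) _ u→a _ = singleVertex-no-arc {G = G} G-net single u→a
  reticulation-parent-excluded {G} (step {R' = G'} {r = cher x y} G-net red crs) conds u→a u-ret =
    ⊥-by-cases (λ a∈r → reticulation≢p u-ret (pair-parent a∈r u→a)) λ a∉r →
    let u→a' = kept-leaf-arc u→a a∉r in
    reticulation-preserved (arc⇒bigNetwork {G = G'} (CompleteCRS-network crs) u→a') u-ret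
      (reticulation-parent-excluded crs (conds a∉r) u→a')
    where
    N : IsBigNetwork G
    N = arc⇒bigNetwork {G = G} G-net u→a
    D : CherryReduction G G' x y
    D = cherryReduction N red
    open CherryReductionProperties N D
  reticulation-parent-excluded {G} (step {R' = G'} {r = ret x y} G-net red crs) (a∉r , conds , _) u→a u-ret =
    reticulation-preserved (arc⇒bigNetwork {G = G'} (CompleteCRS-network crs) u→a') u-ret u≢px
      (reticulation-parent-excluded crs conds u→a')
    where
    N : IsBigNetwork G
    N = arc⇒bigNetwork {G = G} G-net u→a
    D : ReticulatedCherryReduction G G' x y
    D = reticulatedCherryReduction red
    open ReticulatedCherryReduction D
    open ReticulatedCherryReductionProperties N D
    u→a' : A G' _ (inj₁ _)
    u→a' = kept-leaf-arc u→a a∉r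
    u≢px : _ ≢ px
    u≢px refl = a∉r (inj₁ (inj₁-injective (px-child u→a)))

  reticulation-sibling-excluded : ∀ {G : Graph L} {τ a u c} → CompleteCRS G τ → SuccessorConditions a τ →
                                  A G u (inj₁ a) → A G u c → ¬ IsReticulation G c
  reticulation-sibling-excluded {G} (done G-net single) _ u→a _ _ = singleVertex-no-arc {G = G} G-net single u→a
  reticulation-sibling-excluded {G} {c = c} (step {R' = G'} {r = cher x y} G-net red crs) conds u→a u→c c-ret =
    ⊥-by-cases (λ a∈r → p-children (subst (λ v → A G v c) (pair-parent a∈r u→a) u→c)
                          (reticulation-unlabelled c-ret) (reticulation-unlabelled c-ret)) λ a∉r →
    let u→a' = kept-leaf-arc u→a a∉r in
    reticulation-preserved (arc⇒bigNetwork {G = G'} (CompleteCRS-network crs) u→a') c-ret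
      (reticulation-sibling-excluded crs (conds a∉r) u→a' (kept-arc-into-reticulation u→c c-ret))
    where
    N : IsBigNetwork G
    N = arc⇒bigNetwork {G = G} G-net u→a
    D : CherryReduction G G' x y
    D = cherryReduction N red
    open BigNetwork {G = G} N
    open CherryReductionProperties N D
  reticulation-sibling-excluded {G} {a = a} {u} {c} (step {R' = G'} {r = ret x y} G-net red crs)
                                (a∉r , conds , apart) u→a u→c c-ret =
    ⊥-by-cases (λ (c≡px : c ≡ px) →
      ⊥-by-cases (λ (u≡py : u ≡ py) → py-children (subst (λ v → A G v (inj₁ a)) u≡py u→a)
                                        (inj₁-≢ (a∉r ∘ inj₂)) labelled≢px) λ u≢py →
      -- u is the other parent q of px, which becomes the parent of x: then a and x are siblings.
      ⊥-by-cases (λ (u≡q : u ≡ q) → pickedApart⇒¬siblings crs apart (a∉r ∘ inj₁) u→a'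
                                      (subst (λ v → A G' v (inj₁ x)) (sym u≡q) q→x)) λ u≢q →
      px-no-third-parent (subst (A G u) c≡px u→c) u≢py u≢q) λ c≢px →
    reticulation-preserved (arc⇒bigNetwork {G = G'} (CompleteCRS-network crs) u→a') c-ret c≢px
      (reticulation-sibling-excluded crs conds u→a' (kept-arc-into-reticulation u→c c-ret c≢px))
    where
    N : IsBigNetwork G
    N = arc⇒bigNetwork {G = G} G-net u→a
    D : ReticulatedCherryReduction G G' x y
    D = reticulatedCherryReduction red
    open ReticulatedCherryReduction D
    open ReticulatedCherryReductionProperties N D
    u→a' : A G' u (inj₁ a)
    u→a' = kept-leaf-arc u→a a∉r

  ¬reticulationsOnly⇒treeChild : ∀ {R : Graph L} → IsNetwork R →
                                 (∀ {v c} → A R v c → ¬ ReticulationsOnly R v) → IsTreeChild R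
  ¬reticulationsOnly⇒treeChild {R} (inj₁ N) = BigNetwork.¬reticulationsOnly⇒treeChild {G = R} N
  ¬reticulationsOnly⇒treeChild (inj₂ (_ , _ , no-arcs)) _ v _ ¬out0 = ⊥-elim (¬out0 (no-arcs v))

  ¬reticulationsOnly-before-cherry : ∀ {R R' : Graph L} {x y v c₀} → IsBigNetwork R → Reduces R (cher x y) R' →
                              IsNetwork R' → IsTreeChild R' → A R v c₀ → ¬ ReticulationsOnly R v
  ¬reticulationsOnly-before-cherry {R} {R'} {x} {y} {v} N red R'-net R'-tc v→c₀ only-ret =
    ⊥-by-cases (λ v≡p → reticulation-unlabelled (only-ret _ (subst (λ u → A R u (inj₁ x)) (sym v≡p) p→x)) refl)
    λ v≢p → no-good-child (R'-tc v (kept-vertex (source∈V v→c₀) (arc-source-unlabelled v→c₀) v≢p)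
                                    (still-has-child v→c₀ v≢p))
    where
    D : CherryReduction R R' x y
    D = cherryReduction N red
    open BigNetwork {G = R} N
    open CherryReduction D
    open CherryReductionProperties N D
    no-good-child : ¬ (∃[ c ] (A R' v c × TreeOrLeaf R' c))
    no-good-child (c , v→c' , c-ok) with arc-origin v→c'
    ... | inj₁ v→c = reticulation-preserved (arc⇒bigNetwork {G = R'} R'-net v→c') (only-ret c v→c)
                       (Reticulations.treeOrLeaf⇒¬reticulation R' c-ok)
    ... | inj₂ v→p = reticulation≢p (only-ret _ v→p) refl

  ¬reticulationsOnly-before-reticulated-cherry :
    ∀ {R R' : Graph L} {x y τ v c₀} → IsBigNetwork R → Reduces R (ret x y) R' →
    CompleteCRS R' τ → SuccessorConditions x τ → IsTreeChild R' → A R v c₀ → ¬ ReticulationsOnly R v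
  ¬reticulationsOnly-before-reticulated-cherry {R} {R'} {x} {y} {v = v} N red crs conds R'-tc v→c₀ only-ret =
    ⊥-by-cases (λ v≡px → reticulation-unlabelled (only-ret _ (subst (λ u → A R u (inj₁ x)) (sym v≡px) px→x)) refl)
    λ v≢px →
    ⊥-by-cases (λ v≡py → reticulation-unlabelled (only-ret _ (subst (λ u → A R u (inj₁ y)) (sym v≡py) py→y)) refl)
    λ v≢py →
    ⊥-by-cases (λ v≡g → reticulation≢py (only-ret _ (subst (λ u → A R u py) (sym v≡g) g→py)) refl) λ v≢g →
    ⊥-by-cases (λ v≡q → q-not-reticulationsOnly (subst (ReticulationsOnly R) v≡q only-ret)) λ v≢q →
    no-good-child v≢g v≢q (R'-tc v (kept-vertex (source∈V v→c₀) v≢px v≢py) (still-has-child v→c₀ v≢px v≢py))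
    where
    D : ReticulatedCherryReduction R R' x y
    D = reticulatedCherryReduction red
    open BigNetwork {G = R} N
    open ReticulatedCherryReduction D
    open ReticulatedCherryReductionProperties N D
    N' : IsBigNetwork R'
    N' = arc⇒bigNetwork {G = R'} (CompleteCRS-network crs) q→x
    no-good-child : v ≢ g → v ≢ q → ¬ (∃[ c ] (A R' v c × TreeOrLeaf R' c))
    no-good-child v≢g v≢q (c , v→c' , c-ok) with arc-origin v→c'
    ... | inj₁ (v→c , c≢px) = reticulation-preserved N' (only-ret c v→c) c≢px
                                (Reticulations.treeOrLeaf⇒¬reticulation R' c-ok)
    ... | inj₂ (inj₁ v≡g) = v≢g v≡g
    ... | inj₂ (inj₂ v≡q) = v≢q v≡q
    q-not-reticulationsOnly : ¬ ReticulationsOnly R q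
    q-not-reticulationsOnly q-only-ret =
      second-child-or-reticulation q→px
        (λ {c} q→c c≢px → reticulation-preserved N' (q-only-ret c q→c) c≢px
           (reticulation-sibling-excluded crs conds q→x
              (kept-arc-into-reticulation q→c (q-only-ret c q→c) c≢px)))
        (λ q-ret → reticulation-preserved N' q-ret (λ q≡px → no-loop (subst (λ u → A R u px) q≡px q→px))
           (reticulation-parent-excluded crs conds q→x))

  completeCRS⇒treeChild : ∀ {R : Graph L} {σ} → CompleteCRS R σ → IsTreeChildSeq σ → IsTreeChild R
  completeCRS⇒treeChild {R} (done R-net single) _ v _ ¬out0 =
    ⊥-elim (¬out0 (λ _ v→w → singleVertex-no-arc {G = R} R-net single v→w))
  completeCRS⇒treeChild {R} (step {R' = R'} {r = cher x y} R-net red crs) tc =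
    ¬reticulationsOnly⇒treeChild {R = R} R-net λ v→c →
      ¬reticulationsOnly-before-cherry {R} {R'} {x} {y} (arc⇒bigNetwork {G = R} R-net v→c) red (CompleteCRS-network crs)
        (completeCRS⇒treeChild crs (IsTreeChildSeq-tail tc)) v→c
  completeCRS⇒treeChild {R} (step {R' = R'} {r = ret x y} R-net red crs) tc =
    ¬reticulationsOnly⇒treeChild {R = R} R-net λ v→c →
      ¬reticulationsOnly-before-reticulated-cherry {R} {R'} {x} {y} (arc⇒bigNetwork {G = R} R-net v→c) red crs (IsTreeChildSeq-head tc)
        (completeCRS⇒treeChild crs (IsTreeChildSeq-tail tc)) v→c

lemma3p1 : {L : Set} (R : Graph L) → IsNetwork R →
           (∃[ σ ] (CompleteCRS R σ × IsTreeChildSeq σ)) →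
           IsTreeChild R
lemma3p1 R _ (σ , crs , tc) = completeCRS⇒treeChild crs tc
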